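{- Let $T$ be a finite tree which has an optimal symmetry-breaking coloring in which all vertices of the center $C(T)$ receive the same color. Then $D(T) = D(L(T))$.
   Context: For a finite graph $G$, a map $f:V(G) \to \{1,\dotsc,k\}$ is a symmetry-breaking (SB) coloring if for every nontrivial automorphism $\phi$ of $G$ there is a vertex $v$ with $f(v) \neq f(\phi(v))$; the distinguishing number $D(G)$ is the least such $k$, and an SB coloring with $k = D(G)$ is optimal. $L(T)$ is the line graph of $T$. The center $C(T)$ of a tree is the set of vertices of minimum eccentricity; it consists of a single vertex or of the two endpoints of a single edge. -}

module Defs where

open import Data.Nat using (ℕ; zero; suc; _≤_; _<_; _<ᵇ_)
open import Data.Fin using (Fin; toℕ)
open import Data.Bool using (Bool; true; false; _∧_; T)
open import Data.List using (List; []; _∷_; _++_; take; length)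
open import Data.List.Relation.Unary.Unique.Propositional using (Unique)
open import Data.Product using (Σ; ∃; _×_; _,_; proj₁; proj₂)
open import Data.Sum using (_⊎_)
open import Relation.Nullary using (¬_)
open import Relation.Binary.PropositionalEquality using (_≡_; _≢_)
open import Function.Bundles using (_⇔_)

record Graph : Set₁ where
  field
    V   : Set
    Adj : V → V → Set

record Automorphism (G : Graph) : Set where
  open Graph G
  field
    to       : V → V
    from     : V → V
    from-to  : ∀ v → from (to v) ≡ v
    to-from  : ∀ v → to (from v) ≡ v
    preserve : ∀ u v → Adj u v ⇔ Adj (to u) (to v)

Nontrivial : {G : Graph} → Automorphism G → Set
Nontrivial {G} φ = ∃ λ (v : Graph.V G) → Automorphism.to φ v ≢ v

IsSB : (G : Graph) {k : ℕ} → (Graph.V G → Fin k) → Set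
IsSB G f = (φ : Automorphism G) → Nontrivial φ →
           ∃ λ (v : Graph.V G) → f v ≢ f (Automorphism.to φ v)

HasSB : (G : Graph) → ℕ → Set
HasSB G k = Σ (Graph.V G → Fin k) λ f → IsSB G f

IsDistNum : Graph → ℕ → Set
IsDistNum G d = (1 ≤ d) × HasSB G d × (∀ k → 1 ≤ k → k < d → ¬ HasSB G k)

module _ {n : ℕ} (adj : Fin n → Fin n → Bool) where

  data Walk : Fin n → Fin n → Set where
    nil  : ∀ {u} → Walk u u
    cons : ∀ {u w v} → T (adj u w) → Walk w v → Walk u v

  walkLength : ∀ {u v} → Walk u v → ℕ
  walkLength nil        = 0
  walkLength (cons _ w) = suc (walkLength w)

  data Chain : List (Fin n) → Set where
    []  : Chain []
    [_] : ∀ x → Chain (x ∷ [])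
    _∷_ : ∀ {x y xs} → T (adj x y) → Chain (y ∷ xs) → Chain (x ∷ y ∷ xs)

  Connected : Set
  Connected = ∀ u v → Walk u v

  -- a cycle: at least 3 distinct vertices x₀ … x_m, consecutive ones
  -- adjacent, and x_m adjacent to x₀
  Cycle : Set
  Cycle = Σ (List (Fin n)) λ xs →
            (3 ≤ length xs) × Unique xs × Chain (xs ++ take 1 xs)

  Acyclic : Set
  Acyclic = ¬ Cycle

  WithinDist : Fin n → Fin n → ℕ → Set
  WithinDist u v d = Σ (Walk u v) λ w → walkLength w ≤ d

  IsEcc : Fin n → ℕ → Set
  IsEcc u e = (∀ v → WithinDist u v e) ×
              (∀ e′ → (∀ v → WithinDist u v e′) → e ≤ e′)

  InCenter : Fin n → Set
  InCenter c = Σ ℕ λ ec → IsEcc c ec × (∀ u eu → IsEcc u eu → ec ≤ eu)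

record Tree (n : ℕ) : Set where
  field
    adj       : Fin n → Fin n → Bool
    symmetric : ∀ u v → adj u v ≡ adj v u
    irrefl    : ∀ u → adj u u ≡ false
    nonempty  : 1 ≤ n
    connected : Connected adj
    acyclic   : Acyclic adj

module _ {n : ℕ} (t : Tree n) where
  open Tree t

  treeGraph : Graph
  treeGraph = record { V = Fin n ; Adj = λ u v → T (adj u v) }

  -- edges {u,v} represented once, as ordered pairs with u < v
  isEdge : Fin n × Fin n → Bool
  isEdge (u , v) = adj u v ∧ (toℕ u <ᵇ toℕ v)

  EdgeT : Set
  EdgeT = Σ (Fin n × Fin n) λ p → T (isEdge p)

  ShareEndpoint : EdgeT → EdgeT → Set
  ShareEndpoint ((u , v) , _) ((u′ , v′) , _) =
    (u ≡ u′) ⊎ (u ≡ v′) ⊎ (v ≡ u′) ⊎ (v ≡ v′)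

  lineGraph : Graph
  lineGraph = record
    { V   = EdgeT
    ; Adj = λ e e′ → (proj₁ e ≢ proj₁ e′) × ShareEndpoint e e′ }

module Submission where

-- Every vertex of a tree has at most one neighbour of no larger eccentricity; so a non-central
-- vertex v has a unique parent (the neighbour of smaller eccentricity), and the edge to it is
-- the parent edge of v. Automorphisms preserve eccentricity, and for |T| ≥ 3 the automorphisms
-- of T and of L(T) correspond (Whitney): φ acts on edges, and ψ sends an inner vertex to the
-- common end of the images of two of its edges. Colouring each edge by its end farther from
-- the centre turns a symmetry-breaking colouring of T that is constant on the centre into one
-- of L(T); colouring each non-central vertex by its parent edge goes back, because an edge
-- joining two central vertices is fixed by every automorphism. On two
-- vertices the hypothesis cannot hold, and on one vertex both numbers are 1.

open import Defs
open import Data.Nat using (ℕ; zero; suc; _≤_; _<_; _+_; _⊔_; z≤n; s≤s; s≤s⁻¹)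
open import Data.Nat.Properties
open import Data.Nat.Induction using (<-rec)
open import Data.Fin as Fin using (Fin; toℕ) renaming (zero to fz; suc to fs)
import Data.Fin.Properties as Finₚ
open import Data.Bool using (Bool; T)
open import Data.Bool.Properties using (T-∧; T-irrelevant)
open import Data.Unit using (⊤; tt)
open import Data.Empty using (⊥; ⊥-elim)
open import Data.Maybe using (Maybe; just; nothing)
open import Data.Maybe.Properties using (just-injective)
open import Data.List using (List; []; _∷_; _++_)
open import Data.List.Relation.Unary.Any using (here; there)
open import Data.List.Relation.Unary.All as All using (All; []; _∷_)
open import Data.List.Relation.Unary.All.Properties using (¬Any⇒All¬; ++⁻ˡ; ++⁻ʳ)
open import Data.List.Relation.Unary.AllPairs using ([]; _∷_)
open import Data.List.Relation.Unary.Unique.Propositional using (Unique)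
open import Data.List.Membership.Propositional using (_∈_; _∉_)
open import Data.Product using (∃; ∃₂; _×_; _,_; proj₁; proj₂)
open import Data.Sum using (_⊎_; inj₁; inj₂)
open import Relation.Nullary using (¬_; Dec; yes; no)
open import Relation.Nullary.Decidable using (_×-dec_; T?; ¬?)
open import Relation.Nullary.Negation using (contradiction)
open import Relation.Binary.PropositionalEquality
open import Relation.Binary.Definitions using (tri<; tri≈; tri>)
open import Function.Base using (_∘′_)
open import Function.Bundles using (_⇔_; Equivalence; mk⇔)

Unique-++⇒Unique-∷ : ∀ {A : Set} (xs : List A) {ys y} → Unique (xs ++ ys) → y ∈ ys → Unique (y ∷ xs)
Unique-++⇒Unique-∷ [] _ _ = [] ∷ []
Unique-++⇒Unique-∷ (x ∷ xs) (x∉ ∷ unique) y∈ys with Unique-++⇒Unique-∷ xs unique y∈ys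
... | y∉xs ∷ unique-xs =
  ((λ y≡x → All.lookup (++⁻ʳ xs x∉) y∈ys (sym y≡x)) ∷ y∉xs) ∷ (++⁻ˡ xs x∉ ∷ unique-xs)

minimal : {P : ℕ → Set} → (∀ k → Dec (P k)) →
          ∀ b → P b → ∃ λ e → P e × ∀ k → P k → e ≤ k
minimal {P} P? = <-rec _ λ b rec Pb → search b rec Pb (anyUpTo? P? b)
  where
    search : ∀ b → (∀ {j} → j < b → P j → ∃ λ e → P e × ∀ k → P k → e ≤ k) → P b →
             Dec (∃ λ j → j < b × P j) → ∃ λ e → P e × ∀ k → P k → e ≤ k
    search b rec Pb (yes (j , j<b , Pj)) = rec j<b Pj
    search b rec Pb (no ∄) = b , Pb , λ k Pk → ≮⇒≥ λ k<b → ∄ (k , k<b , Pk)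

maxOver : ∀ {m} → (Fin m → ℕ) → ℕ
maxOver {zero} f = 0
maxOver {suc m} f = f fz ⊔ maxOver (λ i → f (fs i))

≤-maxOver : ∀ {m} (f : Fin m → ℕ) i → f i ≤ maxOver f
≤-maxOver f fz = m≤m⊔n _ _
≤-maxOver f (fs i) = ≤-trans (≤-maxOver (λ j → f (fs j)) i) (m≤n⊔m _ _)

adjacencyGraph : ∀ {n} → (Fin n → Fin n → Bool) → Graph
adjacencyGraph {n} adj = record { V = Fin n ; Adj = λ u v → T (adj u v) }

module AutomorphismProperties {G : Graph} (φ : Automorphism G) where
  open Graph G
  open Automorphism φ public

  to-adj : ∀ {a b} → Adj a b → Adj (to a) (to b)
  to-adj {a} {b} = Equivalence.to (preserve a b)

  from-adj : ∀ {a b} → Adj a b → Adj (from a) (from b)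
  from-adj {a} {b} p = Equivalence.from (preserve (from a) (from b))
                         (subst₂ Adj (sym (to-from a)) (sym (to-from b)) p)

  to-injective : ∀ {a b} → to a ≡ to b → a ≡ b
  to-injective {a} {b} eq = trans (sym (from-to a)) (trans (cong from eq) (from-to b))

  inverse : Automorphism G
  inverse = record
    { to = from ; from = to ; from-to = to-from ; to-from = from-to
    ; preserve = λ a b → mk⇔ from-adj (λ p → subst₂ Adj (to-from a) (to-from b) (to-adj p)) }

module Walks {n : ℕ} (adj : Fin n → Fin n → Bool) where

  private
    variable
      u v w : Fin n

  _++ʷ_ : Walk adj u v → Walk adj v w → Walk adj u w
  nil ++ʷ q = q
  cons a p ++ʷ q = cons a (p ++ʷ q)

  walkLength-++ʷ : (p : Walk adj u v) (q : Walk adj v w) →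
                   walkLength adj (p ++ʷ q) ≡ walkLength adj p + walkLength adj q
  walkLength-++ʷ nil q = refl
  walkLength-++ʷ (cons a p) q = cong suc (walkLength-++ʷ p q)

  vertices : Walk adj u v → List (Fin n)
  vertices {u} nil = u ∷ []
  vertices {u} (cons a p) = u ∷ vertices p

  initVertices : Walk adj u v → List (Fin n)
  initVertices nil = []
  initVertices {u} (cons a p) = u ∷ initVertices p

  source∈vertices : (p : Walk adj u v) → u ∈ vertices p
  source∈vertices nil = here refl
  source∈vertices (cons a p) = here refl

  target∈vertices : (p : Walk adj u v) → v ∈ vertices p
  target∈vertices nil = here refl
  target∈vertices (cons a p) = there (target∈vertices p)

  vertices-++ʷ : (p : Walk adj u v) (q : Walk adj v w) →
                 vertices (p ++ʷ q) ≡ initVertices p ++ vertices q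
  vertices-++ʷ nil q = refl
  vertices-++ʷ (cons a p) q = cong (_ ∷_) (vertices-++ʷ p q)

  initVertices-++-target : (p : Walk adj u v) → initVertices p ++ v ∷ [] ≡ vertices p
  initVertices-++-target nil = refl
  initVertices-++-target (cons a p) = cong (_ ∷_) (initVertices-++-target p)

  vertices-chain : (p : Walk adj u v) → Chain adj (vertices p)
  vertices-chain nil = [ _ ]
  vertices-chain (cons a nil) = a ∷ [ _ ]
  vertices-chain (cons a (cons b p)) = a ∷ vertices-chain (cons b p)

  split-∈ : (p : Walk adj u w) → v ∈ vertices p →
            ∃₂ λ (q : Walk adj u v) (r : Walk adj v w) → p ≡ q ++ʷ r
  split-∈ nil (here refl) = nil , nil , refl
  split-∈ (cons a p) (here refl) = nil , cons a p , refl
  split-∈ (cons a p) (there v∈p) with split-∈ p v∈p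
  ... | q , r , refl = cons a q , r , refl

  -- The Maybe argument is the vertex visited just before the walk starts, if any.
  NonBacktrackingAfter : Maybe (Fin n) → Walk adj u v → Set
  NonBacktrackingAfter m nil = ⊤
  NonBacktrackingAfter m (cons {u} {w} a p) = m ≢ just w × NonBacktrackingAfter (just u) p

  NonBacktracking : Walk adj u v → Set
  NonBacktracking = NonBacktrackingAfter nothing

  nonBacktrackingAfter-change : ∀ {m m′} (p : Walk adj u v) →
    (∀ x → m′ ≡ just x → x ∉ vertices p) →
    NonBacktrackingAfter m p → NonBacktrackingAfter m′ p
  nonBacktrackingAfter-change nil _ _ = tt
  nonBacktrackingAfter-change (cons a p) m′∉p (_ , nb) =
    (λ eq → m′∉p _ eq (there (source∈vertices p))) , nb

  nonBacktrackingAfter⇒nonBacktracking : ∀ {m} (p : Walk adj u v) →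
    NonBacktrackingAfter m p → NonBacktracking p
  nonBacktrackingAfter⇒nonBacktracking p = nonBacktrackingAfter-change p (λ _ ())

  -- the vertex visited just before the target; m for the empty walk
  penultimate : Maybe (Fin n) → Walk adj u v → Maybe (Fin n)
  penultimate m nil = m
  penultimate m (cons {u} a p) = penultimate (just u) p

  penultimate-∈ : ∀ m (p : Walk adj u v) →
    penultimate m p ≡ m ⊎ ∃ λ x → penultimate m p ≡ just x × x ∈ vertices p
  penultimate-∈ m nil = inj₁ refl
  penultimate-∈ m (cons {u} a p) with penultimate-∈ (just u) p
  ... | inj₁ eq = inj₂ (u , eq , here refl)
  ... | inj₂ (x , eq , x∈p) = inj₂ (x , eq , there x∈p)

  nonBacktrackingAfter-++ʷ : ∀ m (p : Walk adj u v) (q : Walk adj v w) →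
    NonBacktrackingAfter m p → NonBacktrackingAfter (penultimate m p) q →
    NonBacktrackingAfter m (p ++ʷ q)
  nonBacktrackingAfter-++ʷ m nil q _ nbq = nbq
  nonBacktrackingAfter-++ʷ m (cons a p) q (h , nbp) nbq = h , nonBacktrackingAfter-++ʷ _ p q nbp nbq

  removeBacktracking : (p : Walk adj u v) →
    ∃ λ (q : Walk adj u v) → NonBacktracking q × walkLength adj q ≤ walkLength adj p
  removeBacktracking nil = nil , tt , z≤n
  removeBacktracking (cons {u} a p) with removeBacktracking p
  ... | nil , _ , l = cons a nil , ((λ ()) , tt) , s≤s z≤n
  ... | cons {_} {x} b q , (_ , nb) , l with x Fin.≟ u
  ...   | yes refl = q , nonBacktrackingAfter⇒nonBacktracking q nb , m≤n⇒m≤1+n (<⇒≤ l)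
  ...   | no x≢u = cons a (cons b q) , ((λ ()) , (λ eq → x≢u (sym (just-injective eq))) , nb) , s≤s l

  WithinDist? : ∀ k u v → Dec (WithinDist adj u v k)
  WithinDist? k u v with u Fin.≟ v
  ... | yes refl = yes (nil , z≤n)
  WithinDist? zero u v | no u≢v = no λ { (nil , _) → u≢v refl ; (cons _ _ , ()) }
  WithinDist? (suc k) u v | no u≢v
    with Finₚ.any? (λ w → T? (adj u w) ×-dec WithinDist? k w v)
  ... | yes (w , a , p , l) = yes (cons a p , s≤s l)
  ... | no ∄ = no λ { (nil , _) → u≢v refl ; (cons a p , s≤s l) → ∄ (_ , a , p , l) }

  WithinDist-mono : ∀ {k k′} → WithinDist adj u v k → k ≤ k′ → WithinDist adj u v k′
  WithinDist-mono (p , l) k≤k′ = p , ≤-trans l k≤k′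

module SymmetricWalks {n : ℕ} {adj : Fin n → Fin n → Bool}
                      (symmetric : ∀ u v → adj u v ≡ adj v u) where
  open Walks adj

  private
    variable
      u v : Fin n

  adj-sym : T (adj u v) → T (adj v u)
  adj-sym {u} {v} = subst T (symmetric u v)

  reverse : Walk adj u v → Walk adj v u
  reverse nil = nil
  reverse (cons a p) = reverse p ++ʷ cons (adj-sym a) nil

  walkLength-reverse : (p : Walk adj u v) → walkLength adj (reverse p) ≡ walkLength adj p
  walkLength-reverse nil = refl
  walkLength-reverse (cons a p) = begin
    walkLength adj (reverse p ++ʷ cons (adj-sym a) nil) ≡⟨ walkLength-++ʷ (reverse p) _ ⟩
    walkLength adj (reverse p) + 1                      ≡⟨ +-comm _ 1 ⟩
    suc (walkLength adj (reverse p))                    ≡⟨ cong suc (walkLength-reverse p) ⟩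
    suc (walkLength adj p)                              ∎
    where open ≡-Reasoning

  WithinDist-sym : ∀ {k} → WithinDist adj u v k → WithinDist adj v u k
  WithinDist-sym (p , l) = reverse p , subst (_≤ _) (sym (walkLength-reverse p)) l

module Eccentricity {n : ℕ} {adj : Fin n → Fin n → Bool} (connected : Connected adj) where
  open Walks adj

  private
    variable
      u : Fin n

  Reaches : Fin n → ℕ → Set
  Reaches u k = ∀ v → WithinDist adj u v k

  eccentricity : ∃ (IsEcc adj u)
  eccentricity {u} = minimal (λ k → Finₚ.all? (WithinDist? k u)) bound reachesBound
    where
      bound = maxOver (λ v → walkLength adj (connected u v))
      reachesBound : Reaches u bound
      reachesBound v = connected u v , ≤-maxOver (λ v → walkLength adj (connected u v)) v

  opaque
    ecc : Fin n → ℕ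
    ecc u = proj₁ (eccentricity {u})

    ecc-isEcc : ∀ u → IsEcc adj u (ecc u)
    ecc-isEcc u = proj₂ (eccentricity {u})

  reaches-ecc : ∀ u → Reaches u (ecc u)
  reaches-ecc u = proj₁ (ecc-isEcc u)

  isEcc⇒≡ecc : ∀ {e} → IsEcc adj u e → e ≡ ecc u
  isEcc⇒≡ecc {u} (reaches , least) =
    ≤-antisym (least (ecc u) (reaches-ecc u)) (proj₂ (ecc-isEcc u) _ reaches)

  ecc-minimal⇒inCenter : ∀ {c} → (∀ u → ecc c ≤ ecc u) → InCenter adj c
  ecc-minimal⇒inCenter {c} minimum =
    ecc c , ecc-isEcc c , λ u e isEcc → subst (ecc c ≤_) (sym (isEcc⇒≡ecc isEcc)) (minimum u)

  ecc≡suc⇒far : ∀ u k → ecc u ≡ suc k → ∃ λ w → ¬ WithinDist adj u w k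
  ecc≡suc⇒far u k eq = Finₚ.¬∀⟶∃¬ n _ (WithinDist? k u)
    λ reaches → 1+n≰n (subst (_≤ k) eq (proj₂ (ecc-isEcc u) k reaches))

  automorphism-preserves-ecc : (φ : Automorphism (adjacencyGraph adj)) →
                               ∀ v → ecc (Automorphism.to φ v) ≡ ecc v
  automorphism-preserves-ecc φ v = sym (isEcc⇒≡ecc (reaches , least))
    where
      open AutomorphismProperties φ
      map-within : (g : Fin n → Fin n) → (∀ {a b} → T (adj a b) → T (adj (g a) (g b))) →
                   ∀ {x y k} → WithinDist adj x y k → WithinDist adj (g x) (g y) k
      map-within g g-adj (nil , l) = nil , l
      map-within g g-adj (cons a p , s≤s l) with map-within g g-adj (p , l)
      ... | q , l′ = cons (g-adj a) q , s≤s l′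
      reaches : Reaches (to v) (ecc v)
      reaches w = subst (λ z → WithinDist adj (to v) z (ecc v)) (to-from w)
                    (map-within to to-adj (reaches-ecc v (from w)))
      least : ∀ k → Reaches (to v) k → ecc v ≤ k
      least k r = proj₂ (ecc-isEcc v) k λ w →
        subst₂ (λ x y → WithinDist adj x y k) (from-to v) (from-to w) (map-within from from-adj (r (to w)))

module TreeProperties {n : ℕ} (t : Tree n) where
  open Tree t
  open Walks adj
  open SymmetricWalks symmetric
  open Eccentricity connected

  Adj : Fin n → Fin n → Set
  Adj u v = T (adj u v)

  private
    variable
      a b u v w x : Fin n
      k : ℕ

  adj-irrefl : Adj u v → u ≢ v
  adj-irrefl {u} a refl = subst T (irrefl u) a

  nonBacktrackingAfter-++ʷ⁻ˡ : ∀ m (p : Walk adj u v) (q : Walk adj v w) →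
    NonBacktrackingAfter m (p ++ʷ q) → NonBacktrackingAfter m p
  nonBacktrackingAfter-++ʷ⁻ˡ m nil q _ = tt
  nonBacktrackingAfter-++ʷ⁻ˡ m (cons a p) q (h , nb) = h , nonBacktrackingAfter-++ʷ⁻ˡ _ p q nb

  no-nonBacktracking-return : Adj u w → (q : Walk adj w u) →
    NonBacktrackingAfter (just u) q → Unique (u ∷ initVertices q) → ⊥
  no-nonBacktracking-return a nil _ _ = adj-irrefl a refl
  no-nonBacktracking-return a (cons b nil) (h , _) _ = h refl
  no-nonBacktracking-return a q@(cons _ (cons _ _)) _ unique =
    acyclic (initVertices (cons a q) , s≤s (s≤s (s≤s z≤n)) , unique , chain)
    where
      chain = subst (Chain adj) (sym (initVertices-++-target (cons a q))) (vertices-chain (cons a q))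

  nonBacktracking⇒unique : (p : Walk adj u v) → NonBacktracking p → Unique (vertices p)
  nonBacktracking⇒unique nil _ = [] ∷ []
  nonBacktracking⇒unique (cons {u} a p) (_ , nb) = ¬Any⇒All¬ _ u∉p ∷ unique-p
    where
      unique-p = nonBacktracking⇒unique p (nonBacktrackingAfter⇒nonBacktracking p nb)
      u∉p : u ∉ vertices p
      u∉p u∈p with split-∈ p u∈p
      ... | q , r , refl =
        no-nonBacktracking-return a q (nonBacktrackingAfter-++ʷ⁻ˡ _ q r nb)
          (Unique-++⇒Unique-∷ (initVertices q) (subst Unique (vertices-++ʷ q r) unique-p)
                              (source∈vertices r))

  closed-¬unique : (a : Adj w x) (r : Walk adj x w) → ¬ Unique (vertices (cons a r))
  closed-¬unique a r (w∉r ∷ _) = All.lookup w∉r (target∈vertices r) refl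

  within-suffix : (p : Walk adj x w) → walkLength adj p ≤ suc k →
                  v ∈ vertices p → x ≢ v → WithinDist adj v w k
  within-suffix p l v∈p x≢v with split-∈ p v∈p
  ... | nil , r , refl = ⊥-elim (x≢v refl)
  ... | cons _ q , r , refl =
    r , m+n≤o⇒n≤o (walkLength adj q) (subst (_≤ _) (walkLength-++ʷ q r) (s≤s⁻¹ l))

  within-prefix : (p : Walk adj w x) → walkLength adj p ≤ suc k →
                  v ∈ vertices p → v ≢ x → WithinDist adj w v k
  within-prefix {k = k} p l v∈p v≢x with split-∈ p v∈p
  ... | q , nil , refl = ⊥-elim (v≢x refl)
  ... | q , cons _ r , refl = q , m+n≤o⇒m≤o (walkLength adj q) (s≤s⁻¹ (begin
    suc (walkLength adj q + walkLength adj r) ≡⟨ +-suc _ _ ⟨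
    walkLength adj q + suc (walkLength adj r) ≡⟨ walkLength-++ʷ q (cons _ r) ⟨
    walkLength adj (q ++ʷ cons _ r)           ≤⟨ l ⟩
    suc k                                     ∎))
    where open ≤-Reasoning

  -- Shortest walks w ⇝ a and b ⇝ w would avoid v, so w ⇝ a — v — b ⇝ w would be a closed
  -- non-backtracking walk.
  no-detour : Adj v a → Adj v b → a ≢ b →
              WithinDist adj a w (suc k) → WithinDist adj b w (suc k) → ¬ WithinDist adj v w k → ⊥
  no-detour {v} {a} {b} {w} {k} va vb a≢b (a⇝w , a-near) (b⇝w , b-near) w-far =
    closed-¬unique′ P (nonBacktracking⇒unique (P ++ʷ X) nb-PX)
    where
      P′ = removeBacktracking (reverse a⇝w)
      Q′ = removeBacktracking b⇝w
      P = proj₁ P′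
      Q = proj₁ Q′
      P-length : walkLength adj P ≤ suc k
      P-length = ≤-trans (proj₂ (proj₂ P′)) (subst (_≤ _) (sym (walkLength-reverse a⇝w)) a-near)
      v∉P : v ∉ vertices P
      v∉P v∈P = w-far (WithinDist-sym (within-prefix P P-length v∈P (adj-irrefl va)))
      v∉Q : v ∉ vertices Q
      v∉Q v∈Q = w-far (within-suffix Q (≤-trans (proj₂ (proj₂ Q′)) b-near) v∈Q (adj-irrefl vb ∘′ sym))
      X : Walk adj a w
      X = cons (adj-sym va) (cons vb Q)
      penultimate-P≢v : penultimate nothing P ≢ just v
      penultimate-P≢v eq with penultimate-∈ nothing P
      ... | inj₁ eq′ with () ← trans (sym eq′) eq
      ... | inj₂ (x , eq′ , x∈P) = v∉P (subst (_∈ vertices P) (just-injective (trans (sym eq′) eq)) x∈P)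
      nb-PX : NonBacktracking (P ++ʷ X)
      nb-PX = nonBacktrackingAfter-++ʷ nothing P X (proj₁ (proj₂ P′))
        ( penultimate-P≢v
        , (a≢b ∘′ just-injective)
        , nonBacktrackingAfter-change Q (λ { _ refl → v∉Q }) (proj₁ (proj₂ Q′)) )
      closed-¬unique′ : (p : Walk adj w a) → ¬ Unique (vertices (p ++ʷ X))
      closed-¬unique′ nil = closed-¬unique (adj-sym va) (cons vb Q)
      closed-¬unique′ (cons y p) = closed-¬unique y (p ++ʷ X)

  ecc≤-neighbour-unique : Adj v a → Adj v b → ecc a ≤ ecc v → ecc b ≤ ecc v → a ≡ b
  ecc≤-neighbour-unique {v} {a} {b} va vb a≤v b≤v with a Fin.≟ b | ecc v in ecc-v
  ... | yes a≡b | _ = a≡b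
  ... | no a≢b | zero with reaches-ecc v a
  ...   | nil , _ = ⊥-elim (adj-irrefl va refl)
  ...   | cons _ _ , l with () ← subst (_ ≤_) ecc-v l
  ecc≤-neighbour-unique {v} {a} {b} va vb a≤v b≤v | no a≢b | suc k with ecc≡suc⇒far v k ecc-v
  ... | w , w-far = ⊥-elim (no-detour va vb a≢b
                      (WithinDist-mono (reaches-ecc a w) a≤v) (WithinDist-mono (reaches-ecc b w) b≤v) w-far)

  ecc-increasing : ∀ {prev} (q : Walk adj u v) → NonBacktrackingAfter (just prev) q →
                   Adj u prev → ecc prev ≤ ecc u → u ≡ v ⊎ ecc u < ecc v
  ecc-increasing nil _ _ _ = inj₁ refl
  ecc-increasing {u} (cons {_} {z} b q) (h , nb) u-prev prev≤u with ecc z ≤? ecc u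
  ... | yes z≤u = ⊥-elim (h (cong just (ecc≤-neighbour-unique u-prev b prev≤u z≤u)))
  ... | no z≰u with ecc-increasing q nb (adj-sym b) (<⇒≤ (≰⇒> z≰u))
  ...   | inj₁ refl = inj₂ (≰⇒> z≰u)
  ...   | inj₂ z<v = inj₂ (<-trans (≰⇒> z≰u) z<v)

  LocallyCentral : Fin n → Set
  LocallyCentral r = ∀ a → Adj r a → ecc r ≤ ecc a

  locallyCentral-walk : ∀ {r} → LocallyCentral r → (p : Walk adj r x) → NonBacktracking p →
                        x ≡ r ⊎ (Adj r x × ecc r ≤ ecc x) ⊎ ecc r < ecc x
  locallyCentral-walk central nil _ = inj₁ refl
  locallyCentral-walk central (cons {_} {y} a q) (_ , nb)
    with ecc-increasing q nb (adj-sym a) (central y a)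
  ... | inj₁ refl = inj₂ (inj₁ (a , central _ a))
  ... | inj₂ y<x = inj₂ (inj₂ (≤-<-trans (central y a) y<x))

  locallyCentral⇒ecc-minimal : ∀ {r} → LocallyCentral r → ∀ u → ecc r ≤ ecc u
  locallyCentral⇒ecc-minimal {r} central u with removeBacktracking (connected r u)
  ... | p , nb , _ with locallyCentral-walk central p nb
  ... | inj₁ refl = ≤-refl
  ... | inj₂ (inj₁ (_ , r≤u)) = r≤u
  ... | inj₂ (inj₂ r<u) = <⇒≤ r<u

  flat-edge⇒locallyCentral : Adj u v → ecc u ≡ ecc v → LocallyCentral u
  flat-edge⇒locallyCentral {u} {v} uv u≡v a ua with ecc u ≤? ecc a
  ... | yes u≤a = u≤a
  ... | no u≰a with ecc≤-neighbour-unique ua uv (<⇒≤ (≰⇒> u≰a)) (≤-reflexive (sym u≡v))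
  ...   | refl = contradiction (≤-reflexive u≡v) u≰a

  flat-edge-level : Adj u v → ecc u ≡ ecc v → ecc x ≡ ecc u → x ≡ u ⊎ x ≡ v
  flat-edge-level {u} {v} {x} uv u≡v x≡u with removeBacktracking (connected u x)
  ... | p , nb , _ with locallyCentral-walk (flat-edge⇒locallyCentral uv u≡v) p nb
  ... | inj₁ x≡u′ = inj₁ x≡u′
  ... | inj₂ (inj₁ (ux , _)) =
    inj₂ (ecc≤-neighbour-unique ux uv (≤-reflexive x≡u) (≤-reflexive (sym u≡v)))
  ... | inj₂ (inj₂ u<x) = contradiction (sym x≡u) (<⇒≢ u<x)

  Parent : Fin n → Fin n → Set
  Parent v a = Adj v a × ecc a < ecc v

  opaque
    parent? : ∀ v → Dec (∃ (Parent v))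
    parent? v = Finₚ.any? λ a → T? (adj v a) ×-dec (ecc a <? ecc v)

  parent-unique : Parent v a → Parent v b → a ≡ b
  parent-unique (va , a<v) (vb , b<v) = ecc≤-neighbour-unique va vb (<⇒≤ a<v) (<⇒≤ b<v)

  no-triangle : Adj u v → Adj v w → Adj w u → ⊥
  no-triangle {u} {v} {w} uv vw wu = acyclic
    ( u ∷ v ∷ w ∷ [] , s≤s (s≤s (s≤s z≤n))
    , (adj-irrefl uv ∷ adj-irrefl wu ∘′ sym ∷ []) ∷ (adj-irrefl vw ∷ []) ∷ [] ∷ []
    , uv ∷ vw ∷ wu ∷ [ u ] )

  orphan⇒locallyCentral : ¬ ∃ (Parent v) → LocallyCentral v
  orphan⇒locallyCentral ∄parent a va = ≮⇒≥ λ a<v → ∄parent (a , va , a<v)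

module Edges {n : ℕ} (t : Tree n) where
  open Tree t
  open SymmetricWalks symmetric using (adj-sym)
  open TreeProperties t using (Adj; adj-irrefl; flat-edge-level)
  open Eccentricity connected using (ecc; automorphism-preserves-ecc)

  Edge : Set
  Edge = EdgeT t

  private
    variable
      e e′ : Edge
      x y z : Fin n

  end₁ end₂ : Edge → Fin n
  end₁ e = proj₁ (proj₁ e)
  end₂ e = proj₂ (proj₁ e)

  edge-adj : ∀ e → Adj (end₁ e) (end₂ e)
  edge-adj (_ , p) = proj₁ (Equivalence.to T-∧ p)

  end₁<end₂ : ∀ e → toℕ (end₁ e) < toℕ (end₂ e)
  end₁<end₂ (_ , p) = <ᵇ⇒< _ _ (proj₂ (Equivalence.to T-∧ p))

  ≡-edge : proj₁ e ≡ proj₁ e′ → e ≡ e′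
  ≡-edge {_ , p} {_ , p′} refl = cong (_ ,_) (T-irrelevant p p′)

  _≟ₑ_ : (e e′ : Edge) → Dec (e ≡ e′)
  e ≟ₑ e′ with end₁ e Fin.≟ end₁ e′ | end₂ e Fin.≟ end₂ e′
  ... | yes p | yes q = yes (≡-edge (cong₂ _,_ p q))
  ... | no ¬p | _ = no λ eq → ¬p (cong end₁ eq)
  ... | _ | no ¬q = no λ eq → ¬q (cong end₂ eq)

  edge : ∀ x y → Adj x y → Edge
  edge x y xy with toℕ x <? toℕ y
  ... | yes x<y = (x , y) , Equivalence.from T-∧ (xy , <⇒<ᵇ x<y)
  ... | no x≮y = (y , x) , Equivalence.from T-∧ (adj-sym xy ,
                   <⇒<ᵇ (≤∧≢⇒< (≮⇒≥ x≮y) λ eq → adj-irrefl xy (sym (Finₚ.toℕ-injective eq))))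

  Joins : Edge → Fin n → Fin n → Set
  Joins e x y = proj₁ e ≡ (x , y) ⊎ proj₁ e ≡ (y , x)

  edge-joins : ∀ x y (xy : Adj x y) → Joins (edge x y xy) x y
  edge-joins x y xy with toℕ x <? toℕ y
  ... | yes _ = inj₁ refl
  ... | no _ = inj₂ refl

  joins-ends : ∀ e → Joins e (end₁ e) (end₂ e)
  joins-ends e = inj₁ refl

  joins-sym : Joins e x y → Joins e y x
  joins-sym (inj₁ eq) = inj₂ eq
  joins-sym (inj₂ eq) = inj₁ eq

  joins-unique : Joins e x y → Joins e′ x y → e ≡ e′
  joins-unique (inj₁ p) (inj₁ q) = ≡-edge (trans p (sym q))
  joins-unique (inj₂ p) (inj₂ q) = ≡-edge (trans p (sym q))
  joins-unique {e = e} {e′ = e′} (inj₁ refl) (inj₂ refl) = contradiction (end₁<end₂ e) (<-asym (end₁<end₂ e′))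
  joins-unique {e = e} {e′ = e′} (inj₂ refl) (inj₁ refl) = contradiction (end₁<end₂ e) (<-asym (end₁<end₂ e′))

  joins⇒adj : Joins e x y → Adj x y
  joins⇒adj {e} (inj₁ refl) = edge-adj e
  joins⇒adj {e} (inj₂ refl) = adj-sym (edge-adj e)

  joins⇒≢ : Joins e x y → x ≢ y
  joins⇒≢ {e} j = adj-irrefl (joins⇒adj {e} j)

  _∈ₑ_ : Fin n → Edge → Set
  z ∈ₑ e = z ≡ end₁ e ⊎ z ≡ end₂ e

  ∈ₑ-joins : Joins e x y → z ∈ₑ e → z ≡ x ⊎ z ≡ y
  ∈ₑ-joins (inj₁ refl) z∈e = z∈e
  ∈ₑ-joins (inj₂ refl) (inj₁ eq) = inj₂ eq
  ∈ₑ-joins (inj₂ refl) (inj₂ eq) = inj₁ eq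

  joins⇒∈ₑ₁ : Joins e x y → x ∈ₑ e
  joins⇒∈ₑ₁ (inj₁ refl) = inj₁ refl
  joins⇒∈ₑ₁ (inj₂ refl) = inj₂ refl

  joins⇒∈ₑ₂ : Joins e x y → y ∈ₑ e
  joins⇒∈ₑ₂ {e} j = joins⇒∈ₑ₁ {e} (joins-sym {e} j)

  ∈ₑ-edge₁ : (xy : Adj x y) → x ∈ₑ edge x y xy
  ∈ₑ-edge₁ xy = joins⇒∈ₑ₁ {edge _ _ xy} (edge-joins _ _ xy)

  ∈ₑ-edge₂ : (xy : Adj x y) → y ∈ₑ edge x y xy
  ∈ₑ-edge₂ xy = joins⇒∈ₑ₂ {edge _ _ xy} (edge-joins _ _ xy)

  ∈ₑ-∈ₑ⇒joins : x ∈ₑ e → y ∈ₑ e → x ≢ y → Joins e x y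
  ∈ₑ-∈ₑ⇒joins (inj₁ refl) (inj₁ refl) x≢y = ⊥-elim (x≢y refl)
  ∈ₑ-∈ₑ⇒joins (inj₁ refl) (inj₂ refl) _ = inj₁ refl
  ∈ₑ-∈ₑ⇒joins (inj₂ refl) (inj₁ refl) _ = inj₂ refl
  ∈ₑ-∈ₑ⇒joins (inj₂ refl) (inj₂ refl) x≢y = ⊥-elim (x≢y refl)

  edge-injective : (xy : Adj x y) (xz : Adj x z) → edge x y xy ≡ edge x z xz → y ≡ z
  edge-injective {x} {y} {z} xy xz eq
    with ∈ₑ-joins {edge x y xy} (edge-joins _ _ xy) (subst (z ∈ₑ_) (sym eq) (∈ₑ-edge₂ xz))
  ... | inj₁ z≡x = ⊥-elim (adj-irrefl xz (sym z≡x))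
  ... | inj₂ z≡y = sym z≡y

  -- junk value end₁ e when z is not an end of e
  otherEnd : Edge → Fin n → Fin n
  otherEnd e z with z Fin.≟ end₁ e
  ... | yes _ = end₂ e
  ... | no _ = end₁ e

  otherEnd-∈ₑ : ∀ e z → otherEnd e z ∈ₑ e
  otherEnd-∈ₑ e z with z Fin.≟ end₁ e
  ... | yes _ = inj₂ refl
  ... | no _ = inj₁ refl

  joins-otherEnd : ∀ e z → z ∈ₑ e → Joins e z (otherEnd e z)
  joins-otherEnd e z z∈e with z Fin.≟ end₁ e | z∈e
  ... | yes refl | _ = joins-ends e
  ... | no z≢end₁ | inj₁ eq = ⊥-elim (z≢end₁ eq)
  ... | no _ | inj₂ refl = joins-sym {e} (joins-ends e)

  Meet : Edge → Edge → Set
  Meet e e′ = ∃ λ z → z ∈ₑ e × z ∈ₑ e′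

  shareEndpoint⇔meet : ∀ e e′ → ShareEndpoint t e e′ ⇔ Meet e e′
  shareEndpoint⇔meet e e′ = mk⇔ to from
    where
      to : ShareEndpoint t e e′ → Meet e e′
      to (inj₁ p) = _ , inj₁ refl , inj₁ p
      to (inj₂ (inj₁ p)) = _ , inj₁ refl , inj₂ p
      to (inj₂ (inj₂ (inj₁ p))) = _ , inj₂ refl , inj₁ p
      to (inj₂ (inj₂ (inj₂ p))) = _ , inj₂ refl , inj₂ p
      from : Meet e e′ → ShareEndpoint t e e′
      from (_ , inj₁ refl , inj₁ q) = inj₁ q
      from (_ , inj₁ refl , inj₂ q) = inj₂ (inj₁ q)
      from (_ , inj₂ refl , inj₁ q) = inj₂ (inj₂ (inj₁ q))
      from (_ , inj₂ refl , inj₂ q) = inj₂ (inj₂ (inj₂ q))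

  lineAutomorphism : (f g : Edge → Edge) → (∀ e → g (f e) ≡ e) → (∀ e → f (g e) ≡ e) →
                     (∀ e e′ → Meet e e′ → Meet (f e) (f e′)) →
                     (∀ e e′ → Meet (f e) (f e′) → Meet e e′) → Automorphism (lineGraph t)
  lineAutomorphism f g gf fg f-meet f-meet⁻ = record
    { to = f ; from = g ; from-to = gf ; to-from = fg
    ; preserve = λ e e′ → mk⇔
        (λ (e≢e′ , share) → (λ eq → e≢e′ (cong proj₁ (f-injective (≡-edge eq))))
                          , meet⇒share (f e) (f e′) (f-meet e e′ (share⇒meet e e′ share)))
        (λ (fe≢fe′ , share) → (λ eq → fe≢fe′ (cong (proj₁ ∘′ f) (≡-edge eq)))
                            , meet⇒share e e′ (f-meet⁻ e e′ (share⇒meet (f e) (f e′) share))) }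
    where
      share⇒meet = λ e e′ → Equivalence.to (shareEndpoint⇔meet e e′)
      meet⇒share = λ e e′ → Equivalence.from (shareEndpoint⇔meet e e′)
      f-injective : ∀ {a b} → f a ≡ f b → a ≡ b
      f-injective {a} {b} eq = trans (sym (gf a)) (trans (cong g eq) (gf b))

  module LineAutomorphism (ψ : Automorphism (lineGraph t)) where
    open AutomorphismProperties ψ public

    meet-to : e ≢ e′ → Meet e e′ → Meet (to e) (to e′)
    meet-to {e} {e′} e≢e′ m = Equivalence.to (shareEndpoint⇔meet (to e) (to e′))
      (proj₂ (to-adj (e≢e′ ∘′ ≡-edge , Equivalence.from (shareEndpoint⇔meet e e′) m)))

    meet-from : to e ≢ to e′ → Meet (to e) (to e′) → Meet e e′
    meet-from {e} {e′} te≢te′ m = Equivalence.to (shareEndpoint⇔meet e e′)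
      (proj₂ (Equivalence.from (preserve e e′)
        (te≢te′ ∘′ ≡-edge , Equivalence.from (shareEndpoint⇔meet (to e) (to e′)) m)))

  mapEdge : (g : Fin n → Fin n) → (∀ {a b} → Adj a b → Adj (g a) (g b)) → Edge → Edge
  mapEdge g g-adj e = edge (g (end₁ e)) (g (end₂ e)) (g-adj (edge-adj e))

  module _ (g : Fin n → Fin n) (g-adj : ∀ {a b} → Adj a b → Adj (g a) (g b)) where

    mapEdge-joins : Joins e x y → Joins (mapEdge g g-adj e) (g x) (g y)
    mapEdge-joins (inj₁ refl) = edge-joins _ _ _
    mapEdge-joins {e} (inj₂ refl) = joins-sym {mapEdge g g-adj e} (edge-joins _ _ _)

    mapEdge-∈ₑ : z ∈ₑ e → g z ∈ₑ mapEdge g g-adj e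
    mapEdge-∈ₑ {e = e} (inj₁ refl) = joins⇒∈ₑ₁ {mapEdge g g-adj e} (mapEdge-joins {e} (joins-ends e))
    mapEdge-∈ₑ {e = e} (inj₂ refl) = joins⇒∈ₑ₂ {mapEdge g g-adj e} (mapEdge-joins {e} (joins-ends e))

    mapEdge-stable : g (end₁ e) ∈ₑ e → g (end₂ e) ∈ₑ e → mapEdge g g-adj e ≡ e
    mapEdge-stable {e} end₁↦ end₂↦ = joins-unique (mapEdge-joins {e} (joins-ends e))
      (∈ₑ-∈ₑ⇒joins {e = e} end₁↦ end₂↦ (adj-irrefl (g-adj (edge-adj e))))

    mapEdge-fixed : mapEdge g g-adj e ≡ e → Joins e x y →
                    (g x ≡ x × g y ≡ y) ⊎ (g x ≡ y × g y ≡ x)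
    mapEdge-fixed {e} {x} {y} fixed j =
      ends (∈ₑ-joins {e} j (joins⇒∈ₑ₁ {e} j′)) (∈ₑ-joins {e} j (joins⇒∈ₑ₂ {e} j′))
      where
        j′ : Joins e (g x) (g y)
        j′ = subst (λ e′ → Joins e′ (g x) (g y)) fixed (mapEdge-joins {e} j)
        ends : g x ≡ x ⊎ g x ≡ y → g y ≡ x ⊎ g y ≡ y → (g x ≡ x × g y ≡ y) ⊎ (g x ≡ y × g y ≡ x)
        ends (inj₁ p) (inj₂ q) = inj₁ (p , q)
        ends (inj₂ p) (inj₁ q) = inj₂ (p , q)
        ends (inj₁ p) (inj₁ q) = ⊥-elim (joins⇒≢ {e} j′ (trans p (sym q)))
        ends (inj₂ p) (inj₂ q) = ⊥-elim (joins⇒≢ {e} j′ (trans p (sym q)))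

  flat-edge-fixed : (φ : Automorphism (treeGraph t)) → ecc (end₁ e) ≡ ecc (end₂ e) →
                    let open AutomorphismProperties φ in mapEdge to to-adj e ≡ e
  flat-edge-fixed {e} φ flat = mapEdge-stable to to-adj (level (end₁ e) refl) (level (end₂ e) (sym flat))
    where
      open AutomorphismProperties φ
      level : ∀ x → ecc x ≡ ecc (end₁ e) → to x ∈ₑ e
      level x x-level = flat-edge-level (edge-adj e) flat (trans (automorphism-preserves-ecc φ x) x-level)

  lineAutomorphismOf : Automorphism (treeGraph t) → Automorphism (lineGraph t)
  lineAutomorphismOf φ = lineAutomorphism f g gf fg f-meet f-meet⁻
    where
      open AutomorphismProperties φ
      f = mapEdge to to-adj
      g = mapEdge from from-adj
      gf : ∀ e → g (f e) ≡ e
      gf e = joins-unique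
        (subst₂ (Joins (g (f e))) (from-to (end₁ e)) (from-to (end₂ e))
          (mapEdge-joins from from-adj (mapEdge-joins to to-adj (joins-ends e))))
        (joins-ends e)
      fg : ∀ e → f (g e) ≡ e
      fg e = joins-unique
        (subst₂ (Joins (f (g e))) (to-from (end₁ e)) (to-from (end₂ e))
          (mapEdge-joins to to-adj (mapEdge-joins from from-adj (joins-ends e))))
        (joins-ends e)
      f-meet : ∀ e e′ → Meet e e′ → Meet (f e) (f e′)
      f-meet e e′ (z , z∈e , z∈e′) = to z , mapEdge-∈ₑ to to-adj z∈e , mapEdge-∈ₑ to to-adj z∈e′
      f-meet⁻ : ∀ e e′ → Meet (f e) (f e′) → Meet e e′
      f-meet⁻ e e′ (z , z∈fe , z∈fe′) = subst₂ Meet (gf e) (gf e′)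
        (from z , mapEdge-∈ₑ from from-adj z∈fe , mapEdge-∈ₑ from from-adj z∈fe′)

module LargeTree {m : ℕ} (t : Tree (3 + m)) where
  open Tree t
  open Walks adj
  open SymmetricWalks symmetric using (adj-sym)
  open TreeProperties t
  open Edges t

  private
    variable
      a b u v w : Fin (3 + m)

    avoid-zero-and : (b : Fin (3 + m)) → ∃ λ w → w ≢ fz × w ≢ b
    avoid-zero-and b with b Fin.≟ fs fz
    ... | yes refl = fs (fs fz) , (λ ()) , (λ ())
    ... | no b≢1 = fs fz , (λ ()) , b≢1 ∘′ sym

  avoid-two : (a b : Fin (3 + m)) → ∃ λ w → w ≢ a × w ≢ b
  avoid-two a b with a Fin.≟ fz | b Fin.≟ fz
  ... | yes refl | _ = avoid-zero-and b
  ... | no _ | yes refl = let (w , w≢0 , w≢a) = avoid-zero-and a in w , w≢a , w≢0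
  ... | no a≢0 | no b≢0 = fz , a≢0 ∘′ sym , b≢0 ∘′ sym

  neighbour : ∀ v → ∃ (Adj v)
  neighbour v with avoid-two v v
  ... | w , w≢v , _ with connected v w
  ...   | nil = ⊥-elim (w≢v refl)
  ...   | cons a _ = _ , a

  Inner : Fin (3 + m) → Set
  Inner v = ∃₂ λ a b → Adj v a × Adj v b × a ≢ b

  opaque
    inner? : ∀ v → Dec (Inner v)
    inner? v = Finₚ.any? λ a → Finₚ.any? λ b →
      T? (adj v a) ×-dec T? (adj v b) ×-dec ¬? (a Fin.≟ b)

  other-neighbour : Inner v → ∀ c → ∃ λ a → Adj v a × a ≢ c
  other-neighbour (a , b , va , vb , a≢b) c with a Fin.≟ c
  ... | yes refl = b , vb , a≢b ∘′ sym
  ... | no a≢c = a , va , a≢c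

  leaf-neighbour-unique : ¬ Inner v → Adj v a → Adj v b → a ≡ b
  leaf-neighbour-unique leaf va vb with _ Fin.≟ _
  ... | yes a≡b = a≡b
  ... | no a≢b = ⊥-elim (leaf (_ , _ , va , vb , a≢b))

  leaf-neighbour-inner : ¬ Inner v → Adj v u → Inner u
  leaf-neighbour-inner {v} {u} leaf vu with avoid-two v u
  ... | w , w≢v , w≢u with removeBacktracking (connected v w)
  ...   | nil , _ = ⊥-elim (w≢v refl)
  ...   | cons a nil , _ = ⊥-elim (w≢u (leaf-neighbour-unique leaf a vu))
  ...   | cons a (cons b _) , (_ , v≢next , _) , _ with leaf-neighbour-unique leaf a vu
  ...     | refl = v , _ , adj-sym vu , b , v≢next ∘′ cong just

  leaf-edge : ¬ Inner v → (vu : Adj v u) → ∀ e → v ∈ₑ e → e ≡ edge v u vu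
  leaf-edge {v} leaf vu e v∈e = joins-unique {e} (subst (Joins e v) next≡u j) (edge-joins _ _ vu)
    where
      j = joins-otherEnd e v v∈e
      next≡u = leaf-neighbour-unique leaf (joins⇒adj {e} j) vu

  module _ (φ : Automorphism (treeGraph t)) where
    open AutomorphismProperties φ

    moved-edge : to v ≢ v → (va : Adj v a) → to v ≢ a →
                 mapEdge to to-adj (edge v a va) ≢ edge v a va
    moved-edge {v} {a} moved va to-v≢a fixed with mapEdge-fixed to to-adj fixed (edge-joins v a va)
    ... | inj₁ (to-v≡v , _) = moved to-v≡v
    ... | inj₂ (to-v≡a , _) = to-v≢a to-v≡a

    inner-moved-edge : to v ≢ v → Inner v → Nontrivial {lineGraph t} (lineAutomorphismOf φ)
    inner-moved-edge {v} moved inner with other-neighbour inner (to v)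
    ... | a , va , a≢to-v = edge v a va , moved-edge moved va (a≢to-v ∘′ sym)

    lineAutomorphismOf-nontrivial : Nontrivial φ → Nontrivial {lineGraph t} (lineAutomorphismOf φ)
    lineAutomorphismOf-nontrivial (v , moved) with inner? v
    ... | yes inner = inner-moved-edge moved inner
    ... | no leaf with neighbour v
    ...   | u , vu with to v Fin.≟ u
    ...     | no to-v≢u = edge v u vu , moved-edge moved vu to-v≢u
    ...     | yes refl = inner-moved-edge (moved ∘′ to-injective) (leaf-neighbour-inner leaf vu)

  module Whitney (ψ : Automorphism (lineGraph t)) where
    open LineAutomorphism ψ

    -- Distinct edges at an inner vertex v have images that meet; v is sent to the common end
    -- (junk value v at leaves).
    hubImage : Fin (3 + m) → Fin (3 + m)
    hubImage v with inner? v
    ... | yes (a , b , va , vb , a≢b) =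
      proj₁ (meet-to (a≢b ∘′ edge-injective va vb)
                     (v , ∈ₑ-edge₁ va , ∈ₑ-edge₁ vb))
    ... | no _ = v

    hubImage-∈ₑ : Inner v → ∀ e → v ∈ₑ e → hubImage v ∈ₑ to e
    hubImage-∈ₑ {v} inner e v∈e with inner? v
    ... | no leaf = ⊥-elim (leaf inner)
    ... | yes (a , b , va , vb , a≢b)
      with meet-to (a≢b ∘′ edge-injective va vb)
                   (v , ∈ₑ-edge₁ va , ∈ₑ-edge₁ vb)
    ... | z , z∈ea , z∈eb with e ≟ₑ edge v a va | e ≟ₑ edge v b vb
    ...   | yes refl | _ = z∈ea
    ...   | no _ | yes refl = z∈eb
    ...   | no e≢ea | no e≢eb
      with meet-to e≢ea (v , v∈e , ∈ₑ-edge₁ va)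
         | meet-to e≢eb (v , v∈e , ∈ₑ-edge₁ vb)
    ...   | x , x∈e , x∈ea | y , y∈e , y∈eb with x Fin.≟ z | y Fin.≟ z
    ...     | yes refl | _ = x∈e
    ...     | no _ | yes refl = y∈e
    ...     | no x≢z | no y≢z with x Fin.≟ y
    ...       | yes refl = ⊥-elim (a≢b (edge-injective va vb (to-injective
                  (joins-unique (∈ₑ-∈ₑ⇒joins {e = to (edge v a va)} x∈ea z∈ea x≢z)
                                                    (∈ₑ-∈ₑ⇒joins {e = to (edge v b vb)} y∈eb z∈eb y≢z)))))
    ...       | no x≢y = ⊥-elim (no-triangle
                  (joins⇒adj {to e} (∈ₑ-∈ₑ⇒joins {e = to e} x∈e y∈e x≢y))
                  (joins⇒adj {to (edge v b vb)} (∈ₑ-∈ₑ⇒joins {e = to (edge v b vb)} y∈eb z∈eb y≢z))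
                  (adj-sym (joins⇒adj {to (edge v a va)} (∈ₑ-∈ₑ⇒joins {e = to (edge v a va)} x∈ea z∈ea x≢z))))

    -- A leaf v with neighbour u goes to the end of the image of uv other than the image of u.
    vertexMapBy : ∀ v → Dec (Inner v) → Fin (3 + m)
    vertexMapBy v (yes _) = hubImage v
    vertexMapBy v (no _) = let (u , vu) = neighbour v in otherEnd (to (edge v u vu)) (hubImage u)

    vertexMap : Fin (3 + m) → Fin (3 + m)
    vertexMap v = vertexMapBy v (inner? v)

    vertexMap-inner : Inner v → vertexMap v ≡ hubImage v
    vertexMap-inner {v} inner = by-degree (inner? v)
      where
        by-degree : (d : Dec (Inner v)) → vertexMapBy v d ≡ hubImage v
        by-degree (yes _) = refl
        by-degree (no leaf) = ⊥-elim (leaf inner)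

    vertexMap-∈ₑ : ∀ e → v ∈ₑ e → vertexMap v ∈ₑ to e
    vertexMap-∈ₑ {v} e v∈e with inner? v
    ... | yes inner = hubImage-∈ₑ inner e v∈e
    ... | no leaf = subst (λ e′ → _ ∈ₑ to e′) (sym (leaf-edge leaf (proj₂ (neighbour v)) e v∈e))
                          (otherEnd-∈ₑ (to (edge v _ (proj₂ (neighbour v)))) (hubImage (proj₁ (neighbour v))))

    leaf-vertexMap-≢ : ¬ Inner v → Adj v w → vertexMap v ≢ vertexMap w
    leaf-vertexMap-≢ {v} {w} leaf vw with inner? v
    ... | yes inner = ⊥-elim (leaf inner)
    ... | no _ with neighbour v
    ...   | u , vu with leaf-neighbour-unique leaf vw vu
    ...     | refl = λ eq → joins⇒≢ {to e} (joins-otherEnd (to e) _ hub∈) (trans (sym hub≡) (sym eq))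
      where
        e = edge v w vu
        inner = leaf-neighbour-inner leaf vu
        hub≡ : vertexMap w ≡ hubImage w
        hub≡ = vertexMap-inner inner
        hub∈ : hubImage w ∈ₑ to e
        hub∈ = hubImage-∈ₑ inner e (∈ₑ-edge₂ vu)

    inner-vertexMap-≢ : Inner a → Inner b → Adj a b → vertexMap a ≢ vertexMap b
    inner-vertexMap-≢ {a} {b} inner-a inner-b ab same
      with other-neighbour inner-a b | other-neighbour inner-b a
    ... | p , ap , p≢b | q , bq , q≢a with ea ≟ₑ eb
      where
        ea = edge a p ap
        eb = edge b q bq
    ... | yes ea≡eb with ∈ₑ-joins {edge b q bq} (edge-joins _ _ bq)
                           (subst (a ∈ₑ_) ea≡eb (∈ₑ-edge₁ ap))
    ...   | inj₁ a≡b = adj-irrefl ab a≡b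
    ...   | inj₂ a≡q = q≢a (sym a≡q)
    inner-vertexMap-≢ {a} {b} inner-a inner-b ab same
      | p , ap , p≢b | q , bq , q≢a | no ea≢eb
      with meet-from (ea≢eb ∘′ to-injective) (vertexMap a , image∈ea , image∈eb)
      where
        ea = edge a p ap
        eb = edge b q bq
        image∈ea = vertexMap-∈ₑ ea (∈ₑ-edge₁ ap)
        image∈eb = subst (_∈ₑ to eb) (sym same) (vertexMap-∈ₑ eb (∈ₑ-edge₁ bq))
    ... | w , w∈ea , w∈eb with ∈ₑ-joins {edge a p ap} (edge-joins _ _ ap) w∈ea
                             | ∈ₑ-joins {edge b q bq} (edge-joins _ _ bq) w∈eb
    ...   | inj₁ w≡a | inj₁ w≡b = adj-irrefl ab (trans (sym w≡a) w≡b)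
    ...   | inj₁ w≡a | inj₂ w≡q = q≢a (trans (sym w≡q) w≡a)
    ...   | inj₂ w≡p | inj₁ w≡b = p≢b (trans (sym w≡p) w≡b)
    ...   | inj₂ w≡p | inj₂ w≡q =
      no-triangle ap (subst (λ z → Adj z b) (trans (sym w≡q) w≡p) (adj-sym bq)) (adj-sym ab)

    vertexMap-≢ : Adj a b → vertexMap a ≢ vertexMap b
    vertexMap-≢ {a} {b} ab = by-degree (inner? a) (inner? b)
      where
        by-degree : Dec (Inner a) → Dec (Inner b) → vertexMap a ≢ vertexMap b
        by-degree (no leaf-a) _ = leaf-vertexMap-≢ leaf-a ab
        by-degree (yes _) (no leaf-b) = leaf-vertexMap-≢ leaf-b (adj-sym ab) ∘′ sym
        by-degree (yes inner-a) (yes inner-b) = inner-vertexMap-≢ inner-a inner-b ab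

    vertexMap-joins : ∀ {e x y} → Joins e x y → Joins (to e) (vertexMap x) (vertexMap y)
    vertexMap-joins {e} j = ∈ₑ-∈ₑ⇒joins {e = to e}
      (vertexMap-∈ₑ e (joins⇒∈ₑ₁ {e} j)) (vertexMap-∈ₑ e (joins⇒∈ₑ₂ {e} j)) (vertexMap-≢ (joins⇒adj {e} j))

    vertexMap-adj : Adj a b → Adj (vertexMap a) (vertexMap b)
    vertexMap-adj {a} {b} ab = joins⇒adj {to (edge a b ab)} (vertexMap-joins (edge-joins a b ab))

  module _ (ψ₁ ψ₂ : Automorphism (lineGraph t))
           (inverses : ∀ e → Automorphism.to ψ₂ (Automorphism.to ψ₁ e) ≡ e) where
    private
      module W₁ = Whitney ψ₁
      module W₂ = Whitney ψ₂

      roundTrip : Fin (3 + m) → Fin (3 + m)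
      roundTrip v = W₂.vertexMap (W₁.vertexMap v)

      roundTrip-joins : (vu : Adj v u) → Joins (edge v u vu) (roundTrip v) (roundTrip u)
      roundTrip-joins {v} {u} vu = subst (λ e → Joins e (roundTrip v) (roundTrip u)) (inverses _)
        (W₂.vertexMap-joins {Automorphism.to ψ₁ (edge v u vu)}
          (W₁.vertexMap-joins {edge v u vu} (edge-joins v u vu)))

      roundTrip-near : Adj v u → roundTrip v ≡ v ⊎ roundTrip v ≡ u
      roundTrip-near {v} vu = ∈ₑ-joins {edge v _ vu} (edge-joins _ _ vu)
                               (joins⇒∈ₑ₁ {edge v _ vu} (roundTrip-joins vu))

      roundTrip-inner : Inner v → roundTrip v ≡ v
      roundTrip-inner {v} (a , b , va , vb , a≢b) = fixed (roundTrip-near va) (roundTrip-near vb)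
        where
          fixed : roundTrip v ≡ v ⊎ roundTrip v ≡ a → roundTrip v ≡ v ⊎ roundTrip v ≡ b → roundTrip v ≡ v
          fixed (inj₁ v↦v) _ = v↦v
          fixed (inj₂ _) (inj₁ v↦v) = v↦v
          fixed (inj₂ v↦a) (inj₂ v↦b) = ⊥-elim (a≢b (trans (sym v↦a) v↦b))

      roundTrip-leaf : ¬ Inner v → roundTrip v ≡ v
      roundTrip-leaf {v} leaf = fixed (roundTrip-near v-nbr)
        where
          nbr = proj₁ (neighbour v)
          v-nbr = proj₂ (neighbour v)
          fixed : roundTrip v ≡ v ⊎ roundTrip v ≡ nbr → roundTrip v ≡ v
          fixed (inj₁ v↦v) = v↦v
          fixed (inj₂ v↦nbr) = ⊥-elim (joins⇒≢ {edge v nbr v-nbr} (roundTrip-joins v-nbr)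
                                 (trans v↦nbr (sym (roundTrip-inner (leaf-neighbour-inner leaf v-nbr)))))

    vertexMap-inverse : ∀ v → W₂.vertexMap (W₁.vertexMap v) ≡ v
    vertexMap-inverse v = by-degree (inner? v)
      where
        by-degree : Dec (Inner v) → roundTrip v ≡ v
        by-degree (yes inner) = roundTrip-inner inner
        by-degree (no leaf) = roundTrip-leaf leaf

  vertexAutomorphism : Automorphism (lineGraph t) → Automorphism (treeGraph t)
  vertexAutomorphism ψ = record
    { to = Whitney.vertexMap ψ
    ; from = Whitney.vertexMap ψ⁻¹
    ; from-to = vertexMap-inverse ψ ψ⁻¹ (Automorphism.from-to ψ)
    ; to-from = vertexMap-inverse ψ⁻¹ ψ (Automorphism.to-from ψ)
    ; preserve = λ u v → mk⇔ (Whitney.vertexMap-adj ψ) λ p →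
        subst₂ Adj (vertexMap-inverse ψ ψ⁻¹ (Automorphism.from-to ψ) u)
                   (vertexMap-inverse ψ ψ⁻¹ (Automorphism.from-to ψ) v) (Whitney.vertexMap-adj ψ⁻¹ p) }
    where
      ψ⁻¹ = AutomorphismProperties.inverse ψ

  vertexAutomorphism-nontrivial : ∀ ψ → Nontrivial {lineGraph t} ψ → Nontrivial (vertexAutomorphism ψ)
  vertexAutomorphism-nontrivial ψ (e , moved)
    with vertexMap (end₁ e) Fin.≟ end₁ e | vertexMap (end₂ e) Fin.≟ end₂ e
    where open Whitney ψ
  ... | no moved₁ | _ = end₁ e , moved₁
  ... | yes _ | no moved₂ = end₂ e , moved₂
  ... | yes fixed₁ | yes fixed₂ = ⊥-elim (moved (joins-unique
          (subst₂ (Joins (Automorphism.to ψ e)) fixed₁ fixed₂ (Whitney.vertexMap-joins ψ {e} (joins-ends e)))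
          (joins-ends e)))

  open Eccentricity connected

  module FromLineColouring {k : ℕ} (g : Edge → Fin (suc k)) (g-SB : IsSB (lineGraph t) g) where

    vertexColouring : Fin (3 + m) → Fin (suc k)
    vertexColouring v with parent? v
    ... | yes (a , va , _) = g (edge v a va)
    ... | no _ = fz

    vertexColouring-parent : Parent v a → ∀ e → Joins e v a → vertexColouring v ≡ g e
    vertexColouring-parent {v} {a} (va , a<v) e j with parent? v
    ... | no orphan = ⊥-elim (orphan (a , va , a<v))
    ... | yes (b , vb , b<v) with parent-unique (vb , b<v) (va , a<v)
    ...   | refl = cong g (joins-unique (edge-joins v b vb) j)

    moved-edge⇒moved-colour : (φ : Automorphism (treeGraph t)) → ∀ {e} →
      let open AutomorphismProperties φ in
      g e ≢ g (mapEdge to to-adj e) → Joins e v a → ecc a < ecc v →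
      vertexColouring v ≢ vertexColouring (to v)
    moved-edge⇒moved-colour {v} {a} φ {e} g-moved j a<v same =
      g-moved (trans (sym (vertexColouring-parent (joins⇒adj {e} j , a<v) e j))
              (trans same (vertexColouring-parent (to-adj (joins⇒adj {e} j) , to-a<to-v) _
                                                  (mapEdge-joins to to-adj {e} j))))
      where
        open AutomorphismProperties φ
        to-a<to-v = subst₂ _<_ (sym (automorphism-preserves-ecc φ a))
                               (sym (automorphism-preserves-ecc φ v)) a<v

    vertexColouring-SB : IsSB (treeGraph t) vertexColouring
    vertexColouring-SB φ nontrivial
      with g-SB (lineAutomorphismOf φ) (lineAutomorphismOf-nontrivial φ nontrivial)
    ... | e , g-moved with <-cmp (ecc (end₁ e)) (ecc (end₂ e))
    ...   | tri< end₁<end₂ _ _ =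
      end₂ e , moved-edge⇒moved-colour φ g-moved (joins-sym {e} (joins-ends e)) end₁<end₂
    ...   | tri≈ _ flat _ = ⊥-elim (g-moved (cong g (sym (flat-edge-fixed φ flat))))
    ...   | tri> _ _ end₂<end₁ =
      end₁ e , moved-edge⇒moved-colour φ g-moved (joins-ends e) end₂<end₁

  module ToLineColouring {d : ℕ} (f : Fin (3 + m) → Fin d) (f-SB : IsSB (treeGraph t) f)
                         (centre-monochromatic : ∀ c c′ → InCenter adj c → InCenter adj c′ → f c ≡ f c′) where

    -- the end of e farther from the centre
    child : Edge → Fin (3 + m)
    child e with ecc (end₁ e) <? ecc (end₂ e)
    ... | yes _ = end₂ e
    ... | no _ = end₁ e

    child-joins : ∀ {e x y} → Joins e x y → ecc y < ecc x → child e ≡ x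
    child-joins {e} (inj₁ refl) y<x with ecc (end₁ e) <? ecc (end₂ e)
    ... | yes x<y = ⊥-elim (<-asym y<x x<y)
    ... | no _ = refl
    child-joins {e} (inj₂ refl) y<x with ecc (end₁ e) <? ecc (end₂ e)
    ... | yes _ = refl
    ... | no y≮x = ⊥-elim (y≮x y<x)

    edgeColouring : Edge → Fin d
    edgeColouring e = f (child e)

    edgeColouring-SB : IsSB (lineGraph t) edgeColouring
    edgeColouring-SB ψ nontrivial with f-SB φ (vertexAutomorphism-nontrivial ψ nontrivial)
      where φ = vertexAutomorphism ψ
    ... | w , f-moved with parent? w
    ...   | yes (a , wa , a<w) =
      edge w a wa , λ same → f-moved (begin
        f w                                             ≡⟨ cong f (child-joins (edge-joins w a wa) a<w) ⟨
        edgeColouring (edge w a wa)                     ≡⟨ same ⟩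
        edgeColouring (Automorphism.to ψ (edge w a wa)) ≡⟨ cong f (child-joins ψwa-joins φa<φw) ⟩
        f (vertexMap w)                                 ∎)
      where
        open ≡-Reasoning
        open Whitney ψ using (vertexMap; vertexMap-joins)
        ψwa-joins = vertexMap-joins (edge-joins w a wa)
        preserves = automorphism-preserves-ecc (vertexAutomorphism ψ)
        φa<φw = subst₂ _<_ (sym (preserves a)) (sym (preserves w)) a<w
    ...   | no orphan = ⊥-elim (f-moved (centre-monochromatic _ _ w-central φw-central))
      where
        w-minimal = locallyCentral⇒ecc-minimal (orphan⇒locallyCentral orphan)
        w-central = ecc-minimal⇒inCenter w-minimal
        φw-central = ecc-minimal⇒inCenter λ u →
          subst (_≤ ecc u) (sym (automorphism-preserves-ecc (vertexAutomorphism ψ) w)) (w-minimal u)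

  hasSB-line⇒hasSB-tree : ∀ k → HasSB (lineGraph t) (suc k) → HasSB (treeGraph t) (suc k)
  hasSB-line⇒hasSB-tree k (g , g-SB) = vertexColouring , vertexColouring-SB
    where open FromLineColouring g g-SB

  distinguishingNumber-line : ∀ d (f : Fin (3 + m) → Fin d) →
    IsDistNum (treeGraph t) d → IsSB (treeGraph t) f →
    (∀ c c′ → InCenter adj c → InCenter adj c′ → f c ≡ f c′) → IsDistNum (lineGraph t) d
  distinguishingNumber-line d f (1≤d , _ , tree-minimal) f-SB centre-monochromatic =
    1≤d , (edgeColouring , edgeColouring-SB) , line-minimal
    where
      open ToLineColouring f f-SB centre-monochromatic
      line-minimal : ∀ k → 1 ≤ k → k < d → ¬ HasSB (lineGraph t) k
      line-minimal (suc k) 1≤k k<d = tree-minimal (suc k) 1≤k k<d ∘′ hasSB-line⇒hasSB-tree k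

module SingleVertexTree (t : Tree 1) where
  open Tree t

  no-edge : ¬ Edges.Edge t
  no-edge ((fz , fz) , p) = subst T (irrefl fz) (proj₁ (Equivalence.to T-∧ p))

  hasSB-tree : ∀ k → HasSB (treeGraph t) (suc k)
  hasSB-tree k = (λ _ → fz) , λ { φ (v , moved) → ⊥-elim (moved (singleton _ _)) }
    where
      singleton : (x y : Fin 1) → x ≡ y
      singleton fz fz = refl

  distinguishingNumber-line : ∀ d → IsDistNum (treeGraph t) d → IsDistNum (lineGraph t) d
  distinguishingNumber-line d (1≤d , _ , tree-minimal) =
    1≤d , ((λ e → ⊥-elim (no-edge e)) , λ { ψ (e , _) → ⊥-elim (no-edge e) }) , line-minimal
    where
      line-minimal : ∀ k → 1 ≤ k → k < d → ¬ HasSB (lineGraph t) k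
      line-minimal (suc k) 1≤k k<d _ = tree-minimal (suc k) 1≤k k<d (hasSB-tree k)

-- Both vertices of K₂ are central and swapped by an automorphism, so no symmetry-breaking
-- colouring is constant on the centre.
module TwoVertexTree (t : Tree 2) where
  open Tree t
  open SymmetricWalks symmetric using (adj-sym)
  open TreeProperties t using (Adj; adj-irrefl; flat-edge⇒locallyCentral; locallyCentral⇒ecc-minimal)
  open Eccentricity connected using (automorphism-preserves-ecc; ecc-minimal⇒inCenter)

  swap : Fin 2 → Fin 2
  swap fz = fs fz
  swap (fs fz) = fz

  swap-involutive : ∀ v → swap (swap v) ≡ v
  swap-involutive fz = refl
  swap-involutive (fs fz) = refl

  swap-adj : ∀ u v → Adj u v → Adj (swap u) (swap v)
  swap-adj fz fz uv = ⊥-elim (adj-irrefl uv refl)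
  swap-adj fz (fs fz) uv = adj-sym uv
  swap-adj (fs fz) fz uv = adj-sym uv
  swap-adj (fs fz) (fs fz) uv = ⊥-elim (adj-irrefl uv refl)

  swapAutomorphism : Automorphism (treeGraph t)
  swapAutomorphism = record
    { to = swap ; from = swap ; from-to = swap-involutive ; to-from = swap-involutive
    ; preserve = λ u v → mk⇔ (swap-adj u v) λ p →
        subst₂ Adj (swap-involutive u) (swap-involutive v) (swap-adj (swap u) (swap v) p) }

  adj-01 : Adj fz (fs fz)
  adj-01 with connected fz (fs fz)
  ... | cons {_} {fz} a _ = ⊥-elim (adj-irrefl a refl)
  ... | cons {_} {fs fz} a _ = a

  all-central : ∀ v → InCenter adj v
  all-central v = ecc-minimal⇒inCenter (locallyCentral⇒ecc-minimal
    (flat-edge⇒locallyCentral (adj-swap v) (sym (automorphism-preserves-ecc swapAutomorphism v))))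
    where
      adj-swap : ∀ v → Adj v (swap v)
      adj-swap fz = adj-01
      adj-swap (fs fz) = adj-sym adj-01

  ¬centre-monochromatic : ∀ {d} (f : Fin 2 → Fin d) → IsSB (treeGraph t) f →
    ¬ (∀ c c′ → InCenter adj c → InCenter adj c′ → f c ≡ f c′)
  ¬centre-monochromatic f f-SB centre-monochromatic with f-SB swapAutomorphism (fz , λ ())
  ... | w , f-moved = f-moved (centre-monochromatic _ _ (all-central w) (all-central (swap w)))

proposition10 : ∀ {n : ℕ} (t : Tree n) (d : ℕ) (f : Fin n → Fin d) →
    IsDistNum (treeGraph t) d →
    IsSB (treeGraph t) f →
    (∀ c c′ → InCenter (Tree.adj t) c → InCenter (Tree.adj t) c′ → f c ≡ f c′) →
    IsDistNum (lineGraph t) d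
proposition10 {zero} t _ _ _ _ _ with () ← Tree.nonempty t
proposition10 {1} t d _ isD _ _ = SingleVertexTree.distinguishingNumber-line t d isD
proposition10 {2} t _ f _ f-SB centre-monochromatic =
  ⊥-elim (TwoVertexTree.¬centre-monochromatic t f f-SB centre-monochromatic)
proposition10 {suc (suc (suc m))} t d f isD f-SB centre-monochromatic =
  LargeTree.distinguishingNumber-line t d f isD f-SB centre-monochromatic
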